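{- Let $a, c$ be nonnegative integers. Then there exists a unique nonnegative integer $b$ such that $\mathcal{G}_{\mathcal{E}}(a,b) = c$.
   Context: A position is an unordered pair $(a,b)$ of nonnegative integers (pile sizes). $\mathcal{E}$-Wythoff: a move either removes a positive number of tokens from one pile, or removes the same positive number of tokens from both piles, or removes $k$ tokens from the smaller pile (or from either pile if the piles are equal) and $l$ tokens from the other pile, for integers $k \geq 1$, $l\ge 0$ with $l < k$. $\mathcal{G}_{\mathcal{E}}$ is its Sprague-Grundy function: $\mathcal{G}_{\mathcal{E}}(p)=\mathrm{mex}\{\mathcal{G}_{\mathcal{E}}(q): q \text{ reachable from } p \text{ in one move}\}$, where $\mathrm{mex}(S)$ is the least nonnegative integer not in $S$ and $\mathrm{mex}\{\}=0$. -}

module Defs where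

open import Data.Nat using (ℕ; zero; suc; _+_; _∸_; _≡ᵇ_; _≤ᵇ_; _⊓_)
open import Data.Bool using (Bool; true; false; if_then_else_)
open import Data.List using (List; []; _∷_; _++_; map; concatMap; length; upTo)
open import Data.Bool.ListAction using (any)
open import Data.Product using (_×_; _,_)

-- mex of a finite list of naturals: least natural not occurring in the list.
-- (The mex is always ≤ length l, so searching candidates 0 .. length l suffices.)
mexAux : ℕ → ℕ → List ℕ → ℕ
mexAux zero    c l = c
mexAux (suc f) c l = if any (λ x → x ≡ᵇ c) l then mexAux f (suc c) l else c

mex : List ℕ → ℕ
mex l = mexAux (suc (length l)) 0 l

oneTo : ℕ → List ℕ
oneTo n = map suc (upTo n)

-- All positions reachable in one E-Wythoff move from (a , b).
-- (a , b) is an ordered representative of the unordered pair; the move set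
-- is symmetric, so this describes the moves on the unordered position.
options : ℕ → ℕ → List (ℕ × ℕ)
options a b =
     map (λ i → (a ∸ i , b)) (oneTo a)
  ++ map (λ i → (a , b ∸ i)) (oneTo b)
  ++ map (λ i → (a ∸ i , b ∸ i)) (oneTo (a ⊓ b))
  -- remove k ≥ 1 from the smaller pile (first pile, when a ≤ b) and l < k from the other
  ++ (if a ≤ᵇ b
        then concatMap (λ k → map (λ l → (a ∸ k , b ∸ l)) (upTo k)) (oneTo a)
        else [])
  ++ (if b ≤ᵇ a
        then concatMap (λ k → map (λ l → (a ∸ l , b ∸ k)) (upTo k)) (oneTo b)
        else [])

-- Sprague–Grundy value with fuel; every option has strictly smaller pile sum,
-- so fuel suc (a + b) is sufficient for position (a , b).
grundyFuel : ℕ → ℕ → ℕ → ℕ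
grundyFuel zero    a b = 0
grundyFuel (suc f) a b = mex (map (λ p → go p) (options a b))
  where
  go : ℕ × ℕ → ℕ
  go (x , y) = grundyFuel f x y

G : ℕ → ℕ → ℕ
G a b = grundyFuel (suc (a + b)) a b

-- The argument only uses two geometric facts about E-Wythoff moves from (a , b):
--   * within row a, every smaller second pile (a , b′) with b′ < b is an option;
--   * an option that leaves row a lands in a smaller row x < a and lowers the second
--     pile by at most a (such a move removes no more tokens from the second pile
--     than from the first, or else the first pile is the larger one).
-- Uniqueness: by the first fact the values along a row are pairwise distinct.
-- Existence, by induction on a, together with a bound Y on the columns where c occurs
-- in the rows below a: if c were missing from the window Y + a , … , Y + a + c of
-- row a, then no value there exceeds c (an option of value c in a lower row would
-- have second pile < Y, too small by the second fact), so c + 1 distinct values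
-- would lie below c, contradicting the pigeonhole principle.
module Submission where

open import Defs
open import Data.Nat using (ℕ; zero; suc; _+_; _∸_; _≤_; _<_; z≤n; s≤s; z<s; s≤s⁻¹; _≡ᵇ_; _≟_)
open import Data.Nat.Properties
open import Data.Bool using (true; false; T; if_then_else_)
open import Data.Bool.ListAction using (any)
open import Data.List using (List; []; _++_; map; concatMap; length; upTo; lookup)
open import Data.List.Membership.Propositional using (_∈_; _∉_; find)
open import Data.List.Membership.Propositional.Properties
  using (∈-map⁺; ∈-map⁻; ∈-++⁺ˡ; ∈-++⁺ʳ; ∈-++⁻; ∈-concatMap⁻; ∈-upTo⁺; ∈-upTo⁻)
open import Data.List.Properties using (map-cong-local)
open import Data.List.Relation.Unary.All using (tabulate)
open import Data.List.Relation.Unary.Any as Any using (index)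
open import Data.List.Relation.Unary.Any.Properties using (any⁺; any⁻; lookup-index)
open import Data.Product using (∃-syntax; _×_; _,_; proj₁; uncurry)
open import Data.Sum using (_⊎_; inj₁; inj₂; [_,_])
open import Data.Empty using (⊥-elim)
open import Data.Fin using (toℕ; fromℕ<)
open import Data.Fin.Properties using (pigeonhole; toℕ<n; any?; toℕ-fromℕ<)
open import Relation.Nullary using (¬_; contradiction; yes; no)
open import Relation.Binary.PropositionalEquality hiding ([_])
open import Relation.Binary.Definitions using (tri<; tri≈; tri>)

ContainsBelow : List ℕ → ℕ → Set
ContainsBelow l r = ∀ n → n < r → n ∈ l

containsBelow-bounded : ∀ l r → ContainsBelow l r → r ≤ length l
containsBelow-bounded l r has with r ≤? length l
... | yes r≤len = r≤len
... | no r≰len with pigeonhole (≰⇒> r≰len) (λ i → index (has (toℕ i) (toℕ<n i)))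
... | i , j , i<j , same-index = contradiction (begin
        toℕ i                                   ≡⟨ lookup-index (has (toℕ i) (toℕ<n i)) ⟩
        lookup l (index (has (toℕ i) (toℕ<n i))) ≡⟨ cong (lookup l) same-index ⟩
        lookup l (index (has (toℕ j) (toℕ<n j))) ≡⟨ lookup-index (has (toℕ j) (toℕ<n j)) ⟨
        toℕ j                                   ∎) (<⇒≢ i<j)
  where open ≡-Reasoning

occurs⇒∈ : ∀ l c → T (any (λ x → x ≡ᵇ c) l) → c ∈ l
occurs⇒∈ l c t = Any.map (λ {x} x≡ᵇc → sym (≡ᵇ⇒≡ x c x≡ᵇc)) (any⁻ (λ x → x ≡ᵇ c) l t)

∈⇒occurs : ∀ l c → c ∈ l → T (any (λ x → x ≡ᵇ c) l)
∈⇒occurs l c c∈l = any⁺ (λ x → x ≡ᵇ c) (Any.map (λ { refl → ≡⇒≡ᵇ c c refl }) c∈l)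

mexAux-spec : ∀ l f c → ContainsBelow l c →
  ContainsBelow l (mexAux f c l) × (mexAux f c l ∉ l ⊎ mexAux f c l ≡ f + c)
mexAux-spec l zero    c has = has , inj₂ refl
mexAux-spec l (suc f) c has with any (λ x → x ≡ᵇ c) l in occurs
... | false = has , inj₁ (λ c∈l → subst T occurs (∈⇒occurs l c c∈l))
... | true with mexAux-spec l f (suc c) has′
  where
  has′ : ContainsBelow l (suc c)
  has′ n n<1+c with m≤n⇒m<n∨m≡n (s≤s⁻¹ n<1+c)
  ... | inj₁ n<c  = has n n<c
  ... | inj₂ refl = occurs⇒∈ l c (subst T (sym occurs) _)
...   | has″ , inj₁ missing  = has″ , inj₁ missing
...   | has″ , inj₂ ran-out = has″ , inj₂ (trans ran-out (+-suc f c))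

mex-∉ : ∀ l → mex l ∉ l
mex-∉ l with mexAux-spec l (suc (length l)) 0 (λ _ ())
... | _   , inj₁ missing = missing
... | has , inj₂ ran-out = λ _ → <-irrefl refl (begin-strict
        length l             <⟨ n<1+n (length l) ⟩
        suc (length l)       ≡⟨ cong suc (+-identityʳ (length l)) ⟨
        suc (length l) + 0   ≡⟨ ran-out ⟨
        mex l                ≤⟨ containsBelow-bounded l (mex l) has ⟩
        length l             ∎)
  where open ≤-Reasoning

mex-minimal : ∀ l n → n < mex l → n ∈ l
mex-minimal l = proj₁ (mexAux-spec l (suc (length l)) 0 (λ _ ()))

data Move (a b : ℕ) : ℕ × ℕ → Set where
  inRow    : ∀ {y} → y < b → Move a b (a , y)
  lowerRow : ∀ {x y} → x < a → y ≤ b → b ≤ y + a → Move a b (x , y)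

move-decreases : ∀ {a b x y} → Move a b (x , y) → x + y < a + b
move-decreases {a} (inRow y<b)          = +-monoʳ-< a y<b
move-decreases     (lowerRow x<a y≤b _) = +-mono-<-≤ x<a y≤b

takeSecond : ∀ {a b i} → 0 < i → i ≤ b → Move a b (a , b ∸ i)
takeSecond 0<i i≤b = inRow (∸-monoʳ-< {o = 0} 0<i i≤b)

takeFirstAndSecond : ∀ {a b i l} → 0 < i → i ≤ a → l ≤ a → Move a b (a ∸ i , b ∸ l)
takeFirstAndSecond {a} {b} {l = l} 0<i i≤a l≤a =
  lowerRow (∸-monoʳ-< {o = 0} 0<i i≤a) (m∸n≤m b l) (begin
    b              ≤⟨ m≤n+m∸n b l ⟩
    l + (b ∸ l)    ≤⟨ +-monoˡ-≤ (b ∸ l) l≤a ⟩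
    a + (b ∸ l)    ≡⟨ +-comm a (b ∸ l) ⟩
    (b ∸ l) + a    ∎)
  where open ≤-Reasoning

takeSmallerSecond : ∀ {a b k l} → b ≤ a → 0 < k → k ≤ b → l < k → Move a b (a ∸ l , b ∸ k)
takeSmallerSecond {l = zero}  _   0<k k≤b _   = takeSecond 0<k k≤b
takeSmallerSecond {l = suc l} b≤a _   k≤b l<k =
  takeFirstAndSecond z<s (≤-trans (<⇒≤ l<k) k≤a) k≤a
  where k≤a = ≤-trans k≤b b≤a

∈-oneTo⁻ : ∀ {i n} → i ∈ oneTo n → 0 < i × i ≤ n
∈-oneTo⁻ i∈ with ∈-map⁻ suc i∈
... | j , j∈ , refl = z<s , ∈-upTo⁻ j∈

∈-oneTo⁺ : ∀ {i n} → 0 < i → i ≤ n → i ∈ oneTo n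
∈-oneTo⁺ {suc j} _ 1+j≤n = ∈-map⁺ suc (∈-upTo⁺ 1+j≤n)

module MembershipCases {A : Set} (P : A → Set) where

  from-oneTo : ∀ {f : ℕ → A} {n p} → (∀ {i} → 0 < i → i ≤ n → P (f i)) →
               p ∈ map f (oneTo n) → P p
  from-oneTo {f} h p∈ with ∈-map⁻ f p∈
  ... | i , i∈ , refl = uncurry h (∈-oneTo⁻ i∈)

  from-pairs : ∀ {f : ℕ → ℕ → A} {n p} → (∀ {k l} → 0 < k → k ≤ n → l < k → P (f k l)) →
               p ∈ concatMap (λ k → map (f k) (upTo k)) (oneTo n) → P p
  from-pairs {f} {n} h p∈ with find (∈-concatMap⁻ (λ k → map (f k) (upTo k)) {xs = oneTo n} p∈)
  ... | k , k∈ , p∈′ with ∈-map⁻ (f k) p∈′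
  ... | l , l∈ , refl = let 0<k , k≤n = ∈-oneTo⁻ k∈ in h 0<k k≤n (∈-upTo⁻ l∈)

  from-if : ∀ {t L p} → (T t → p ∈ L → P p) → p ∈ (if t then L else []) → P p
  from-if {true} h p∈ = h _ p∈

  from-++ : ∀ {xs ys : List A} {p} → p ∈ xs ++ ys → (p ∈ xs → P p) → (p ∈ ys → P p) → P p
  from-++ {xs} p∈ left right = [ left , right ] (∈-++⁻ xs p∈)

options-move : ∀ a b {p} → p ∈ options a b → Move a b p
options-move a b p∈ =
  let open MembershipCases (Move a b) in
  from-++ p∈ (from-oneTo (λ 0<i i≤a → takeFirstAndSecond 0<i i≤a z≤n)) λ p∈ →
  from-++ p∈ (from-oneTo takeSecond) λ p∈ →
  from-++ p∈ (from-oneTo (λ 0<i i≤a⊓b →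
    let i≤a = ≤-trans i≤a⊓b (m⊓n≤m a b) in takeFirstAndSecond 0<i i≤a i≤a)) λ p∈ →
  from-++ p∈ (from-if (λ _ → from-pairs (λ 0<k k≤a l<k →
    takeFirstAndSecond 0<k k≤a (≤-trans (<⇒≤ l<k) k≤a))))
  (from-if (λ b≤ᵇa → from-pairs (takeSmallerSecond (≤ᵇ⇒≤ b a b≤ᵇa))))

row-option : ∀ a {b b′} → b′ < b → (a , b′) ∈ options a b
row-option a {b} {b′} b′<b =
  ∈-++⁺ʳ (map (λ i → (a ∸ i , b)) (oneTo a)) (∈-++⁺ˡ (subst (λ y → (a , y) ∈ secondPileMoves)
    (m∸[m∸n]≡n (<⇒≤ b′<b))
    (∈-map⁺ (λ i → (a , b ∸ i)) (∈-oneTo⁺ (m<n⇒0<n∸m b′<b) (m∸n≤m b b′)))))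
  where
  secondPileMoves : List (ℕ × ℕ)
  secondPileMoves = map (λ i → (a , b ∸ i)) (oneTo b)

optionValues : ℕ → ℕ → List ℕ
optionValues a b = map (uncurry G) (options a b)

grundyFuel-stable : ∀ f g x y → x + y < f → x + y < g → grundyFuel f x y ≡ grundyFuel g x y
grundyFuel-stable (suc f) (suc g) x y (s≤s x+y≤f) (s≤s x+y≤g) =
  cong mex (map-cong-local {xs = options x y} (tabulate λ { {u , v} uv∈ →
    let decreases = move-decreases (options-move x y uv∈) in
    grundyFuel-stable f g u v (≤-trans decreases x+y≤f) (≤-trans decreases x+y≤g) }))

G-mex : ∀ a b → G a b ≡ mex (optionValues a b)
G-mex a b = cong mex (map-cong-local {xs = options a b} (tabulate λ { {u , v} uv∈ →
  grundyFuel-stable (a + b) (suc (u + v)) u v (move-decreases (options-move a b uv∈)) ≤-refl }))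

option-value-≢ : ∀ a b {p} → p ∈ options a b → uncurry G p ≢ G a b
option-value-≢ a b p∈ same = mex-∉ (optionValues a b)
  (subst (_∈ optionValues a b) (trans same (G-mex a b)) (∈-map⁺ (uncurry G) p∈))

smaller-value-realised : ∀ a b n → n < G a b → ∃[ p ] (p ∈ options a b × uncurry G p ≡ n)
smaller-value-realised a b n n<G
  with ∈-map⁻ (uncurry G) (mex-minimal (optionValues a b) n (subst (n <_) (G-mex a b) n<G))
... | p , p∈ , n≡Gp = p , p∈ , sym n≡Gp

row-injective : ∀ a {b b′} → b′ < b → G a b′ ≢ G a b
row-injective a b′<b = option-value-≢ a _ (row-option a b′<b)

row-unique : ∀ a c {b b′} → G a b ≡ c → G a b′ ≡ c → b′ ≡ b
row-unique a c {b} {b′} Gb≡c Gb′≡c with <-cmp b′ b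
... | tri< b′<b _ _ = contradiction (trans Gb′≡c (sym Gb≡c)) (row-injective a b′<b)
... | tri≈ _ b′≡b _ = b′≡b
... | tri> _ _ b<b′ = contradiction (trans Gb≡c (sym Gb′≡c)) (row-injective a b<b′)

RowBound : ℕ → ℕ → ℕ → Set
RowBound a c Y = ∀ x y → x < a → G x y ≡ c → y < Y

-- Past column Y + a, a row missing c so far cannot overshoot c: an option of value c
-- in a lower row has second pile below Y, too far from b for a single move.
no-overshoot : ∀ a c Y b → RowBound a c Y → Y + a ≤ b → (∀ y → y < b → G a y ≢ c) → ¬ c < G a b
no-overshoot a c Y b bound Y+a≤b missing c<G with smaller-value-realised a b c c<G
... | p , p∈ , Gp≡c with options-move a b p∈
... | inRow y<b = missing _ y<b Gp≡c
... | lowerRow {y = y} x<a _ b≤y+a = <-irrefl refl (begin-strict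
        y + a   <⟨ +-monoˡ-< a (bound _ y x<a Gp≡c) ⟩
        Y + a   ≤⟨ Y+a≤b ⟩
        b       ≤⟨ b≤y+a ⟩
        y + a   ∎)
  where open ≤-Reasoning

window-below : ∀ a c Y → RowBound a c Y → (∀ y → y < Y + a + suc c → G a y ≢ c) →
               ∀ j → j < suc c → G a (Y + a + j) < c
window-below a c Y bound missing j j≤c =
  ≤∧≢⇒< (≮⇒≥ (no-overshoot a c Y (Y + a + j) bound (m≤m+n (Y + a) j) missing-before))
        (missing _ b<end)
  where
  b<end : Y + a + j < Y + a + suc c
  b<end = +-monoʳ-< (Y + a) j≤c
  missing-before : ∀ y → y < Y + a + j → G a y ≢ c
  missing-before y y<b = missing y (<-trans y<b b<end)

-- A row cannot carry c + 1 consecutive columns with values below c: those values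
-- are pairwise distinct, which the pigeonhole principle forbids.
no-crowded-window : ∀ a c b₀ → ¬ (∀ j → j < suc c → G a (b₀ + j) < c)
no-crowded-window a c b₀ below with pigeonhole (n<1+n c) (λ j → fromℕ< (below (toℕ j) (toℕ<n j)))
... | i , j , i<j , same = contradiction (begin
        G a (b₀ + toℕ i)                        ≡⟨ toℕ-fromℕ< (below (toℕ i) (toℕ<n i)) ⟨
        toℕ (fromℕ< (below (toℕ i) (toℕ<n i))) ≡⟨ cong toℕ same ⟩
        toℕ (fromℕ< (below (toℕ j) (toℕ<n j))) ≡⟨ toℕ-fromℕ< (below (toℕ j) (toℕ<n j)) ⟩
        G a (b₀ + toℕ j)                        ∎) (row-injective a (+-monoʳ-< b₀ i<j))
  where open ≡-Reasoning

value-occurs : ∀ a c Y → RowBound a c Y → ∃[ b ] G a b ≡ c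
value-occurs a c Y bound with any? {n = Y + a + suc c} (λ i → G a (toℕ i) ≟ c)
... | yes (i , Gi≡c) = toℕ i , Gi≡c
... | no none = ⊥-elim (no-crowded-window a c (Y + a) (window-below a c Y bound missing))
  where
  missing : ∀ y → y < Y + a + suc c → G a y ≢ c
  missing y y<end Gy≡c = none (fromℕ< y<end , subst (λ z → G a z ≡ c) (sym (toℕ-fromℕ< y<end)) Gy≡c)

row-bound : ∀ a c → ∃[ Y ] RowBound a c Y
row-bound zero    c = 0 , λ _ _ ()
row-bound (suc a) c with row-bound a c
... | Y , bound with value-occurs a c Y bound
... | b , Gb≡c = Y + suc b , bound′
  where
  bound′ : RowBound (suc a) c (Y + suc b)
  bound′ x y x<1+a Gxy≡c with m≤n⇒m<n∨m≡n (s≤s⁻¹ x<1+a)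
  ... | inj₁ x<a  = <-≤-trans (bound x y x<a Gxy≡c) (m≤m+n Y (suc b))
  ... | inj₂ refl rewrite row-unique a c Gb≡c Gxy≡c = ≤-trans (n<1+n b) (m≤n+m (suc b) Y)

theorem3p3 : (a c : ℕ) → ∃[ b ] (G a b ≡ c × ((b′ : ℕ) → G a b′ ≡ c → b′ ≡ b))
theorem3p3 a c with row-bound a c
... | Y , bound with value-occurs a c Y bound
... | b , Gb≡c = b , Gb≡c , λ b′ Gb′≡c → row-unique a c Gb≡c Gb′≡c
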